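{- Let $(f_n)_{n\in\mathbb N}$ be a Boolean function family. Then there exists a projective Boolean function family $(g_n)_{n\in\mathbb N}$ such that $(f_n)$ is non-uniform linear-length $\mathcal{IS}_{br}$-reducible to $(g_n)$.
   Context: Let $\mathbb B=\{\mathsf T,\mathsf F\}$. There are Boolean registers named $\mathtt{in}{:}i$, $\mathtt{aux}{:}i$ ($i\ge1$) and $\mathtt{out}$, processing methods $\mathtt{set{:}T}$ (content becomes $\mathsf T$, reply $\mathsf T$), $\mathtt{set{:}F}$ (content becomes $\mathsf F$, reply $\mathsf F$), $\mathtt{get}$ (no change, reply is the content). Basic instructions are $f.m$. Primitive instructions: for each basic instruction $a$, the plain instruction $a$, positive test $+a$, negative test $-a$; forward jumps $\#l$ ($l\in\mathbb N$); termination $!$. An instruction sequence is a finite non-empty sequence $X=u_1;\dots;u_k$ of primitive instructions, $|X|=k$. Execution starts at $u_1$: $a$ executes $a$ and proceeds with the next instruction; $+a$ executes $a$ and proceeds with the next instruction if the reply is $\mathsf T$, otherwise skips the next instruction and proceeds with the one after; $-a$ likewise with reply roles reversed; $\#l$ proceeds with the $l$-th next instruction ($\#0$ causes inaction); $!$ terminates; if there is no instruction to proceed with, inaction occurs. $\mathcal{IS}_{br}$ is the set of instruction sequences whose basic instructions are all of the forms $\mathtt{in}{:}i.\mathtt{get}$, $\mathtt{aux}{:}i.\mathtt{get}$, $\mathtt{aux}{:}i.\mathtt{set{:}}b$, $\mathtt{out}.\mathtt{set{:}}b$. $X$ computes $f:\mathbb B^n\to\mathbb B$ if for all $b_1,\dots,b_n$,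 executing $X$ with $\mathtt{in}{:}i$ initially $b_i$ ($i\le n$) and all auxiliary registers and $\mathtt{out}$ initially $\mathsf F$, execution never executes an instruction on $\mathtt{in}{:}i$ with $i>n$, ends by executing $!$, and leaves $f(b_1,\dots,b_n)$ in $\mathtt{out}$. A Boolean function family is a sequence $(f_n)_{n\in\mathbb N}$ with $f_n:\mathbb B^n\to\mathbb B$. It is projective if $f_n(b_1,\dots,b_n)=f_{n+1}(b_1,\dots,b_n,\mathsf F)$ for all $n$ and $b_1,\dots,b_n\in\mathbb B$. For $l,m,n\in\mathbb N$, $f:\mathbb B^n\to\mathbb B$ and $g:\mathbb B^m\to\mathbb B$, $f\le_l g$ if there exist $h_1,\dots,h_m:\mathbb B^n\to\mathbb B$ computed by $X_1,\dots,X_m\in\mathcal{IS}_{br}$ with $|X_j|\le l$ such that $f(b)=g(h_1(b),\dots,h_m(b))$ for all $b\in\mathbb B^n$. $(f_n)$ is non-uniform linear-length $\mathcal{IS}_{br}$-reducible to $(g_n)$ if there is a linear function $h:\mathbb N\to\mathbb N$ such that for every $n$ there exist $l,m\le h(n)$ with $f_n\le_l g_m$. -}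

module Defs where

open import Data.Bool using (Bool; true; false; not; if_then_else_)
open import Data.Nat using (ℕ; zero; suc; _+_; _*_; _≤_; _<?_)
open import Data.Fin using (Fin; fromℕ<)
open import Data.Vec using (Vec; lookup; tabulate; _∷ʳ_)
open import Data.List using (List; []; _∷_; drop)
open import Data.List.NonEmpty using (List⁺; toList) renaming (length to length⁺)
open import Data.Maybe using (Maybe; just; nothing)
open import Data.Product using (Σ; _×_; _,_; ∃; ∃-syntax)
open import Relation.Nullary using (yes; no)
open import Relation.Binary.PropositionalEquality using (_≡_)

BoolFun : ℕ → Set
BoolFun n = Vec Bool n → Bool

BoolFamily : Set
BoolFamily = (n : ℕ) → BoolFun n

-- Basic instructions of IS_br.
-- Register indices are written with an offset: the constructor argument i
-- denotes register in:(i+1) resp. aux:(i+1)  (registers are numbered from 1).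
data BasicInstr : Set where
  inGet  : ℕ → BasicInstr
  auxGet : ℕ → BasicInstr
  auxSet : ℕ → Bool → BasicInstr
  outSet : Bool → BasicInstr

data PrimInstr : Set where
  plain : BasicInstr → PrimInstr
  ptest : BasicInstr → PrimInstr
  ntest : BasicInstr → PrimInstr
  jump  : ℕ → PrimInstr
  halt  : PrimInstr

InstrSeq : Set
InstrSeq = List⁺ PrimInstr

record State : Set where
  constructor st
  field
    aux : ℕ → Bool
    out : Bool

update : (ℕ → Bool) → ℕ → Bool → ℕ → Bool
update f i b j with i Data.Nat.≟ j
... | yes _ = b
... | no  _ = f j

act : {n : ℕ} → Vec Bool n → BasicInstr → State → Maybe (Bool × State)
act {n} bs (inGet i) s with i <? n
... | yes i<n = just (lookup bs (fromℕ< i<n) , s)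
... | no  _   = nothing
act bs (auxGet i)   s = just (State.aux s i , s)
act bs (auxSet i b) s = just (b , st (update (State.aux s) i b) (State.out s))
act bs (outSet b)   s = just (b , st (State.aux s) b)

-- Execution of the remaining instructions (the list is the suffix starting at
-- the current instruction).  Result: just s if execution ends by executing !
-- in final state s; nothing if inaction occurs or an input register beyond n
-- is accessed.  Since all jumps are forward, |X| steps of fuel suffice.
exec : {n : ℕ} → Vec Bool n → ℕ → List PrimInstr → State → Maybe State
exec bs zero    _              s = nothing
exec bs (suc k) []             s = nothing
exec bs (suc k) (halt ∷ xs)    s = just s
exec bs (suc k) (jump zero ∷ xs) s = nothing
exec bs (suc k) (jump (suc l) ∷ xs) s = exec bs k (drop l xs) s
exec bs (suc k) (plain a ∷ xs) s with act bs a s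
... | nothing       = nothing
... | just (_ , s') = exec bs k xs s'
exec bs (suc k) (ptest a ∷ xs) s with act bs a s
... | nothing           = nothing
... | just (true  , s') = exec bs k xs s'
... | just (false , s') = exec bs k (drop 1 xs) s'
exec bs (suc k) (ntest a ∷ xs) s with act bs a s
... | nothing           = nothing
... | just (false , s') = exec bs k xs s'
... | just (true  , s') = exec bs k (drop 1 xs) s'

initState : State
initState = st (λ _ → false) false

run : {n : ℕ} → InstrSeq → Vec Bool n → Maybe State
run X bs = exec bs (length⁺ X) (toList X) initState

outOf : Maybe State → Maybe Bool
outOf nothing  = nothing
outOf (just s) = just (State.out s)

Computes : {n : ℕ} → InstrSeq → BoolFun n → Set
Computes X f = ∀ bs → outOf (run X bs) ≡ just (f bs)

Projective : BoolFamily → Set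
Projective g = ∀ n (bs : Vec Bool n) → g n bs ≡ g (suc n) (bs ∷ʳ false)

_≤[_]_ : {n m : ℕ} → BoolFun n → ℕ → BoolFun m → Set
_≤[_]_ {n} {m} f l g =
  Σ (Fin m → BoolFun n) λ h →
    (∀ j → ∃[ X ] (length⁺ X ≤ l × Computes X (h j))) ×
    (∀ bs → f bs ≡ g (tabulate (λ j → h j bs)))

LinReducible : BoolFamily → BoolFamily → Set
LinReducible f g =
  ∃[ a ] ∃[ c ] ∀ n → ∃[ l ] ∃[ m ]
    (l ≤ a * n + c × m ≤ a * n + c × (f n ≤[ l ] g m))

-- Encode b₁ … bₙ as b₁ T b₂ T … bₙ T, and let gₘ(c) apply f to the input read off c
-- pair by pair up to the first pair whose marker is F.  Appending F to c never changes
-- what is read, so (gₘ) is projective; and fₙ(b) = g₂ₙ(encode b), where every bit of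
-- encode b is an input bit or the constant T, each computed by a program of length 3.
module Submission where

open import Defs

open import Data.Bool using (Bool; true; false)
open import Data.Nat using (ℕ; suc; _+_; _*_; _≤_; _<?_; s≤s; z≤n)
open import Data.Nat.Properties using (*-comm; m≤m+n; m≤n+m; ≤-refl; ≤-reflexive; ≤-trans)
open import Data.Fin using (Fin; toℕ) renaming (zero to fzero; suc to fsuc)
open import Data.Fin.Properties using (fromℕ<-toℕ; toℕ<n)
open import Data.Vec using (Vec; []; _∷_; _∷ʳ_; lookup; tabulate)
open import Data.Vec.Properties using (tabulate∘lookup; tabulate-cong)
open import Data.List using ([]; _∷_)
open import Data.List.NonEmpty using (_∷_) renaming (length to length⁺)
open import Data.Maybe using (Maybe; just; nothing) renaming (map to mapMaybe)
open import Data.Product using (Σ; _×_; _,_; ∃-syntax; uncurry) renaming (map to mapΣ)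
open import Relation.Nullary using (yes; no)
open import Relation.Nullary.Negation using (contradiction)
open import Relation.Binary.PropositionalEquality using (_≡_; refl; sym; trans; cong)
open Relation.Binary.PropositionalEquality.≡-Reasoning

encode : ∀ {n} → Vec Bool n → Vec Bool (n * 2)
encode []       = []
encode (b ∷ bs) = b ∷ true ∷ encode bs

decode : ∀ {m} → Vec Bool m → Σ ℕ (Vec Bool)
decode (b ∷ true ∷ c) = mapΣ suc (b ∷_) (decode c)
decode _              = 0 , []

decode-encode : ∀ {n} (bs : Vec Bool n) → decode (encode bs) ≡ (n , bs)
decode-encode []       = refl
decode-encode (b ∷ bs) = cong (mapΣ suc (b ∷_)) (decode-encode bs)

decode-∷ʳ-false : ∀ {m} (c : Vec Bool m) → decode (c ∷ʳ false) ≡ decode c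
decode-∷ʳ-false []              = refl
decode-∷ʳ-false (b ∷ [])        = refl
decode-∷ʳ-false (b ∷ true ∷ c)  = cong (mapΣ suc (b ∷_)) (decode-∷ʳ-false c)
decode-∷ʳ-false (b ∷ false ∷ c)  = refl

onDecoded : BoolFamily → BoolFamily
onDecoded f m c = uncurry f (decode c)

onDecoded-projective : (f : BoolFamily) → Projective (onDecoded f)
onDecoded-projective f n c = cong (uncurry f) (sym (decode-∷ʳ-false c))

-- Position of a bit of encode bs: the input bit i, or a marker T (nothing).
Entry : ℕ → Set
Entry n = Maybe (Fin n)

readEntry : ∀ {n} → Entry n → BoolFun n
readEntry (just i) bs = lookup bs i
readEntry nothing  bs = true

readEntry-mapMaybe-fsuc : ∀ {n} b (bs : Vec Bool n) (e : Entry n) →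
                          readEntry (mapMaybe fsuc e) (b ∷ bs) ≡ readEntry e bs
readEntry-mapMaybe-fsuc b bs (just i) = refl
readEntry-mapMaybe-fsuc b bs nothing  = refl

entry : ∀ {n} → Fin (n * 2) → Entry n
entry {suc n} fzero           = just fzero
entry {suc n} (fsuc fzero)    = nothing
entry {suc n} (fsuc (fsuc j)) = mapMaybe fsuc (entry j)

lookup-encode : ∀ {n} (bs : Vec Bool n) (j : Fin (n * 2)) →
                lookup (encode bs) j ≡ readEntry (entry j) bs
lookup-encode (b ∷ bs) fzero           = refl
lookup-encode (b ∷ bs) (fsuc fzero)    = refl
lookup-encode (b ∷ bs) (fsuc (fsuc j)) =
  trans (lookup-encode bs j) (sym (readEntry-mapMaybe-fsuc b bs (entry j)))

tabulate-readEntry : ∀ {n} (bs : Vec Bool n) →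
                     tabulate (λ j → readEntry (entry j) bs) ≡ encode bs
tabulate-readEntry bs = begin
  tabulate (λ j → readEntry (entry j) bs) ≡⟨ tabulate-cong (λ j → sym (lookup-encode bs j)) ⟩
  tabulate (lookup (encode bs))           ≡⟨ tabulate∘lookup (encode bs) ⟩
  encode bs                               ∎

act-inGet : ∀ {n} (bs : Vec Bool n) (i : Fin n) s →
            act bs (inGet (toℕ i)) s ≡ just (lookup bs i , s)
act-inGet {n} bs i s with toℕ i <? n
... | yes i<n = cong (λ k → just (lookup bs k , s)) (fromℕ<-toℕ i i<n)
... | no  i≮n = contradiction (toℕ<n i) i≮n

entryProgram : ∀ {n} → Entry n → InstrSeq
entryProgram (just i) = ptest (inGet (toℕ i)) ∷ plain (outSet true) ∷ halt ∷ []
entryProgram nothing  = plain (outSet true) ∷ halt ∷ []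

entryProgram-length : ∀ {n} (e : Entry n) → length⁺ (entryProgram e) ≤ 3
entryProgram-length (just i) = ≤-refl
entryProgram-length nothing  = s≤s (s≤s z≤n)

entryProgram-computes : ∀ {n} (e : Entry n) → Computes (entryProgram e) (readEntry e)
entryProgram-computes (just i) bs rewrite act-inGet bs i initState with lookup bs i
... | true  = refl
... | false = refl
entryProgram-computes nothing bs = refl

≤₃-onDecoded : (f : BoolFamily) (n : ℕ) → f n ≤[ 3 ] onDecoded f (n * 2)
≤₃-onDecoded f n = (λ j → readEntry (entry j)) , programs , reduces
  where
  programs : ∀ j → ∃[ X ] (length⁺ X ≤ 3 × Computes X (readEntry (entry j)))
  programs j = entryProgram e , entryProgram-length e , entryProgram-computes e
    where
    e : Entry n
    e = entry j

  reduces : ∀ bs → f n bs ≡ onDecoded f (n * 2) (tabulate (λ j → readEntry (entry j) bs))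
  reduces bs = begin
    f n bs                                 ≡⟨ cong (uncurry f) (sym (decode-encode bs)) ⟩
    onDecoded f (n * 2) (encode bs)        ≡⟨ cong (onDecoded f (n * 2)) (sym (tabulate-readEntry bs)) ⟩
    onDecoded f (n * 2) (tabulate (λ j → readEntry (entry j) bs)) ∎

theorem15 : (f : BoolFamily) → Σ BoolFamily (λ g → Projective g × LinReducible f g)
theorem15 f = onDecoded f , onDecoded-projective f , (2 , 3 , reduction)
  where
  reduction : ∀ n → ∃[ l ] ∃[ m ] (l ≤ 2 * n + 3 × m ≤ 2 * n + 3 × (f n ≤[ l ] onDecoded f m))
  reduction n = 3 , n * 2 , m≤n+m 3 (2 * n)
              , ≤-trans (≤-reflexive (*-comm n 2)) (m≤m+n (2 * n) 3)
              , ≤₃-onDecoded f n
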